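{- Let $F$ be rule $234$ on the square grid, let $x\in\{0,1\}^{\{0,\dots,n-1\}^2}$ and let $u\in\{0,\dots,n-1\}^2$ be stable for $D(c)$. Then there exist three paths in $G[Z]$, each starting at $u$ and ending at a site of the border $B$, pairwise having only $u$ in common, and such that every site on these paths is stable for $D(c)$.
   Context: Square grid: neighbors of $u\in\mathbb{Z}^2$ are the four cells at Manhattan distance 1. Rule $234$: $F(c)_u=1$ if $c_u=1$ or the number of active neighbors of $u$ lies in $\{2,3,4\}$, else $F(c)_u=0$, applied synchronously (1 = active, 0 = inactive). A cell $u$ with $c_u=0$ is stable for $c$ if $F^t(c)_u=0$ for all $t\ge0$. Construction $D$: let $m=2n^2+3n$ and index an $m\times m$ block by $\{ -n^2-n,\dots,n^2+2n-1\}^2$; set $D(x)_{(i,j)}=x_{(i\bmod n,\,j\bmod n)}$ if $-n^2\le i,j\le n^2+n-1$ (the interior), and $D(x)_{(i,j)}=0$ otherwise. The border $B$ is the set of sites of the block outside the interior (a frame of width $n$). $D(c)$ is the periodic configuration obtained by repeating $D(x)$ in all directions (an $m\times m$ torus). $Z$ is the set of sites $w$ of the block with $D(x)_w=0$, and $G[Z]$ is the graph on $Z$ in which two sites are adjacent iff they are von Neumann neighbors in the torus $(\mathbb{Z}/m\mathbb{Z})^2$. -}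

module Defs where

open import Data.Bool using (Bool; true; false; _∨_; _∧_; if_then_else_)
open import Data.Nat as ℕ using (ℕ; zero; suc; NonZero; _≤ᵇ_)
open import Data.Nat.DivMod using (_%_)
open import Data.Integer as ℤ using (ℤ; +_; -_)
open import Data.Integer.DivMod using (_%ℕ_)
open import Data.Fin using (Fin; toℕ)
open import Data.Product using (_×_; _,_; proj₁; proj₂)
open import Data.Sum using (_⊎_)
open import Data.List using (List; []; _∷_)
open import Data.List.Relation.Unary.All using (All)
open import Data.List.Relation.Unary.Linked using (Linked)
open import Data.List.Relation.Unary.Unique.Propositional using (Unique)
open import Data.List.Membership.Propositional using (_∈_)
open import Relation.Binary.PropositionalEquality using (_≡_)
open import Function using (_∘_)

Site : Set
Site = ℤ × ℤ

Config : Set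
Config = Site → Bool

-- 1 = active = true, 0 = inactive = false
b2n : Bool → ℕ
b2n true  = 1
b2n false = 0

activeNbrs : Config → Site → ℕ
activeNbrs c (i , j) =
  b2n (c (i ℤ.+ ℤ.1ℤ , j)) ℕ.+ b2n (c (i ℤ.- ℤ.1ℤ , j)) ℕ.+
  b2n (c (i , j ℤ.+ ℤ.1ℤ)) ℕ.+ b2n (c (i , j ℤ.- ℤ.1ℤ))

F234 : Config → Config
F234 c u = c u ∨ ((2 ≤ᵇ activeNbrs c u) ∧ (activeNbrs c u ≤ᵇ 4))

iterateF : ℕ → Config → Config
iterateF zero    c = c
iterateF (suc t) c = F234 (iterateF t c)

Stable : Config → Site → Set
Stable c u = c u ≡ false × (∀ (t : ℕ) → iterateF t c u ≡ false)

blockSize : ℕ → ℕ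
blockSize n = 2 ℕ.* (n ℕ.* n) ℕ.+ 3 ℕ.* n

-- offset n² + n : block index i ∈ {-n²-n, …, n²+2n-1} corresponds to
-- the natural number i + n² + n ∈ {0, …, m-1}
offset : ℕ → ℕ
offset n = n ℕ.* n ℕ.+ n

blockSize-nonZero : ∀ n → .{{NonZero n}} → NonZero (blockSize n)
blockSize-nonZero (suc k) = _

InBlock1 : ℕ → ℤ → Set
InBlock1 n i = (- (+ offset n)) ℤ.≤ i × i ℤ.≤ (+ (n ℕ.* n ℕ.+ 2 ℕ.* n)) ℤ.- ℤ.1ℤ

InBlock : ℕ → Site → Set
InBlock n (i , j) = InBlock1 n i × InBlock1 n j

Interior1 : ℕ → ℤ → Set
Interior1 n i = (- (+ (n ℕ.* n))) ℤ.≤ i × i ℤ.≤ (+ (n ℕ.* n ℕ.+ n)) ℤ.- ℤ.1ℤ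

Interior : ℕ → Site → Set
Interior n (i , j) = Interior1 n i × Interior1 n j

Border : ℕ → Site → Set
Border n w = InBlock n w × (Interior n w → Data.Empty.⊥)
  where import Data.Empty

-- boolean interior test on the shifted coordinate a = i + n² + n ∈ {0,…,m-1}
interiorᵇ : ℕ → ℕ → Bool
interiorᵇ n a = (n ≤ᵇ a) ∧ (a ≤ᵇ (2 ℕ.* (n ℕ.* n) ℕ.+ 2 ℕ.* n ℕ.∸ 1))

-- D(c): the m-periodic configuration obtained by repeating D(x).
-- A site (i , j) ∈ ℤ² is reduced to the block index (a - n² - n, b - n² - n)
-- with a = (i + n² + n) mod m, b = (j + n² + n) mod m; on the interior the
-- value is x_(i mod n, j mod n) (note i mod n = a mod n since n ∣ n² + n),
-- and 0 on the border.
Dc : (n : ℕ) → .{{NonZero n}} → (Fin n → Fin n → Bool) → Config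
Dc n x (i , j) =
  let a = (i ℤ.+ + offset n) %ℕ blockSize n
      b = (j ℤ.+ + offset n) %ℕ blockSize n
  in if interiorᵇ n a ∧ interiorᵇ n b
     then x (Data.Fin.fromℕ< (Data.Nat.DivMod.m%n<n a n))
            (Data.Fin.fromℕ< (Data.Nat.DivMod.m%n<n b n))
     else false
  where
    instance _ = blockSize-nonZero n
    import Data.Fin
    import Data.Nat.DivMod

InZ : (n : ℕ) → .{{NonZero n}} → (Fin n → Fin n → Bool) → Site → Set
InZ n x w = InBlock n w × Dc n x w ≡ false

ModEq : (m : ℕ) → .{{NonZero m}} → ℤ → ℤ → Set
ModEq m a b = (a ℤ.- b) %ℕ m ≡ 0

TorusAdj : (n : ℕ) → .{{NonZero n}} → Site → Site → Set
TorusAdj n (i , j) (i' , j') =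
    (ModEq m i i' × (ModEq m (j ℤ.+ ℤ.1ℤ) j' ⊎ ModEq m (j' ℤ.+ ℤ.1ℤ) j))
  ⊎ (ModEq m j j' × (ModEq m (i ℤ.+ ℤ.1ℤ) i' ⊎ ModEq m (i' ℤ.+ ℤ.1ℤ) i))
  where
    m = blockSize n
    instance _ = blockSize-nonZero n

lastOf : Site → List Site → Site
lastOf u []       = u
lastOf u (w ∷ ws) = lastOf w ws

-- a path in G[Z] from u to the border B, given by its vertex list u ∷ ws:
-- vertices in Z, pairwise distinct, consecutive vertices torus-adjacent,
-- last vertex in B
PathToBorder : (n : ℕ) → .{{NonZero n}} → (Fin n → Fin n → Bool) →
               Site → List Site → Set
PathToBorder n x u ws =
  All (InZ n x) (u ∷ ws) × Unique (u ∷ ws) ×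
  Linked (TorusAdj n) (u ∷ ws) × Border n (lastOf u ws)

OnlyCommon : Site → List Site → List Site → Set
OnlyCommon u ws vs = ∀ w → w ∈ (u ∷ ws) → w ∈ (u ∷ vs) → w ≡ u

siteOf : ∀ {n} → Fin n × Fin n → Site
siteOf (a , b) = (+ toℕ a , + toℕ b)

module Submission where

-- Rule 234 only switches cells on, and D(c) is m-periodic (m = 2n² + 3n).
-- Periodicity is preserved by the rule, so the orbit is governed by the
-- finitely many cells of one period and is constant from some time T on.
-- Hence a cell is stable iff it is inactive at time T; stability is
-- decidable, and a stable cell has at most one unstable neighbour, since two
-- active neighbours at time T would switch it on at time T + 1.
-- From a stable interior site we walk greedily through stable sites in two
-- perpendicular directions d₁, d₂ (a staircase walk): the walk never turns
-- back, so it is a path, and it leaves the interior onto the border frame.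
-- Three stable neighbours a, b, -a of u give staircase walks in the
-- quadrants (a, -b), (b, a), (-a, b), which are disjoint apart from u.

open import Defs
open import Data.Nat using (ℕ; NonZero)
open import Data.Fin using (Fin)
open import Data.Bool using (Bool)
open import Data.Product using (_×_; Σ)
open import Data.List using (List; _∷_)
open import Data.List.Relation.Unary.All using (All)

open import Data.Bool using (true; false; _∨_; _∧_; if_then_else_)
open import Data.Bool.Properties using (∨-zeroʳ; T-≡)
open import Data.Empty using (⊥; ⊥-elim)
open import Data.Product using (_,_; proj₁; proj₂)
open import Data.Fin using (fromℕ<)
open import Data.Fin.Properties using (toℕ<n)
open import Data.Integer as ℤ using (ℤ; +_; -_; 0ℤ; 1ℤ)
import Data.Integer.Properties as ℤP
open import Data.Integer.DivMod using (_%ℕ_; _/ℕ_; a≡a%ℕn+[a/ℕn]*n; n%ℕd<d)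
open import Data.Integer.Tactic.RingSolver using (solve-∀)
open import Data.Nat.Tactic.RingSolver using () renaming (solve-∀ to ℕ-solve-∀)
open import Data.List using ([]; map; length; upTo; cartesianProductWith)
open import Data.List.Membership.Propositional using (_∈_)
open import Data.List.Membership.Propositional.Properties
  using (∈-upTo⁺; ∈-cartesianProductWith⁺)
open import Data.List.Relation.Unary.All using ([]; _∷_; lookup) renaming (map to all-map)
open import Data.List.Relation.Unary.Any using (here; there)
open import Data.List.Relation.Unary.AllPairs using ([]; _∷_)
open import Data.List.Relation.Unary.Linked using (Linked; [-]; _∷_)
open import Data.List.Relation.Unary.Unique.Propositional using (Unique)
open import Data.Nat as ℕ using (zero; suc; z≤n; s≤s; _≤ᵇ_)
open import Data.Nat.DivMod using (m%n<n; m<n⇒m%n≡m)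
open import Data.Nat.ListAction using (sum)
import Data.Nat.Properties as ℕP
open import Data.Sum using (_⊎_; inj₁; inj₂)
open import Function using (_∘_; Equivalence)
open import Relation.Binary.PropositionalEquality
open import Relation.Nullary using (¬_; Dec; yes; no)
open import Relation.Nullary.Decidable using (_×-dec_)

small-multiple : ∀ M (d : ℤ) → ℤ.∣ d ℤ.* + M ∣ ℕ.< M → d ℤ.* + M ≡ 0ℤ
small-multiple M d small = by-cases ℤ.∣ d ∣ refl
  where
  by-cases : ∀ k → ℤ.∣ d ∣ ≡ k → d ℤ.* + M ≡ 0ℤ
  by-cases zero    ∣d∣≡0 = cong (ℤ._* + M) (ℤP.∣i∣≡0⇒i≡0 {d} ∣d∣≡0)
  by-cases (suc k) ∣d∣≡ = ⊥-elim (ℕP.<⇒≱ small (subst (M ℕ.≤_) (sym ∣dM∣≡) (ℕP.m≤m+n M (k ℕ.* M))))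
    where
    ∣dM∣≡ : ℤ.∣ d ℤ.* + M ∣ ≡ suc k ℕ.* M
    ∣dM∣≡ = trans (ℤP.abs-* d (+ M)) (cong (ℕ._* M) ∣d∣≡)

%ℕ-unique : ∀ M .{{_ : NonZero M}} {z q : ℤ} {r : ℕ} →
            r ℕ.< M → z ≡ + r ℤ.+ q ℤ.* + M → z %ℕ M ≡ r
%ℕ-unique M {z} {q} {r} r<M z≡ =
  sym (ℤP.+-injective (ℤP.i-j≡0⇒i≡j _ _ (trans gap (small-multiple M (q′ ℤ.- q) small))))
  where
  r′ = z %ℕ M
  q′ = z /ℕ M
  -- both decompositions of z agree, so r - r′ is a multiple of M
  gap : + r ℤ.- + r′ ≡ (q′ ℤ.- q) ℤ.* + M
  gap = begin
    + r ℤ.- + r′                                          ≡⟨ regroup (+ r) (+ r′) q q′ (+ M) ⟩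
    (+ r ℤ.+ q ℤ.* + M) ℤ.- (+ r′ ℤ.+ q′ ℤ.* + M) ℤ.+ (q′ ℤ.- q) ℤ.* + M
      ≡⟨ cong₂ (λ a b → a ℤ.- b ℤ.+ (q′ ℤ.- q) ℤ.* + M) (sym z≡) (sym (a≡a%ℕn+[a/ℕn]*n z M)) ⟩
    z ℤ.- z ℤ.+ (q′ ℤ.- q) ℤ.* + M                       ≡⟨ cancel z ((q′ ℤ.- q) ℤ.* + M) ⟩
    (q′ ℤ.- q) ℤ.* + M                                    ∎
    where
    open ≡-Reasoning
    regroup : ∀ r r′ q q′ M →
              r ℤ.- r′ ≡ (r ℤ.+ q ℤ.* M) ℤ.- (r′ ℤ.+ q′ ℤ.* M) ℤ.+ (q′ ℤ.- q) ℤ.* M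
    regroup = solve-∀
    cancel : ∀ z a → z ℤ.- z ℤ.+ a ≡ a
    cancel = solve-∀
  small : ℤ.∣ (q′ ℤ.- q) ℤ.* + M ∣ ℕ.< M
  small = subst (λ d → ℤ.∣ d ∣ ℕ.< M) gap
    (subst (λ d → ℤ.∣ d ∣ ℕ.< M) (sym (ℤP.[+m]-[+n]≡m⊖n r r′))
      (ℕP.≤-<-trans (ℤP.∣m⊝n∣≤m⊔n r r′) (ℕP.⊔-lub r<M (n%ℕd<d z M))))

%ℕ-+-multiple : ∀ M .{{_ : NonZero M}} (z q : ℤ) → (z ℤ.+ q ℤ.* + M) %ℕ M ≡ z %ℕ M
%ℕ-+-multiple M z q = %ℕ-unique M {q = z /ℕ M ℤ.+ q} (n%ℕd<d z M) (begin
  z ℤ.+ q ℤ.* + M                                      ≡⟨ cong (λ a → a ℤ.+ q ℤ.* + M) (a≡a%ℕn+[a/ℕn]*n z M) ⟩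
  + (z %ℕ M) ℤ.+ z /ℕ M ℤ.* + M ℤ.+ q ℤ.* + M          ≡⟨ regroup (+ (z %ℕ M)) (z /ℕ M) q (+ M) ⟩
  + (z %ℕ M) ℤ.+ (z /ℕ M ℤ.+ q) ℤ.* + M                ∎)
  where
  open ≡-Reasoning
  regroup : ∀ r p q M → r ℤ.+ p ℤ.* M ℤ.+ q ℤ.* M ≡ r ℤ.+ (p ℤ.+ q) ℤ.* M
  regroup = solve-∀

%ℕ-+-cong : ∀ M .{{_ : NonZero M}} (a b k : ℤ) →
            a %ℕ M ≡ b %ℕ M → (a ℤ.+ k) %ℕ M ≡ (b ℤ.+ k) %ℕ M
%ℕ-+-cong M a b k a≡b = begin
  (a ℤ.+ k) %ℕ M                ≡⟨ reduce a ⟩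
  (+ (a %ℕ M) ℤ.+ k) %ℕ M       ≡⟨ cong (λ r → (+ r ℤ.+ k) %ℕ M) a≡b ⟩
  (+ (b %ℕ M) ℤ.+ k) %ℕ M       ≡⟨ reduce b ⟨
  (b ℤ.+ k) %ℕ M                ∎
  where
  open ≡-Reasoning
  regroup : ∀ r p k M → r ℤ.+ p ℤ.* M ℤ.+ k ≡ r ℤ.+ k ℤ.+ p ℤ.* M
  regroup = solve-∀
  -- a + k = (a mod M + k) + (a / M)·M
  reduce : ∀ a → (a ℤ.+ k) %ℕ M ≡ (+ (a %ℕ M) ℤ.+ k) %ℕ M
  reduce a = trans
    (cong (λ z → (z ℤ.+ k) %ℕ M) (a≡a%ℕn+[a/ℕn]*n a M))
    (trans (cong (_%ℕ M) (regroup (+ (a %ℕ M)) (a /ℕ M) k (+ M)))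
           (%ℕ-+-multiple M (+ (a %ℕ M) ℤ.+ k) (a /ℕ M)))

count : {A : Set} → (A → Bool) → List A → ℕ
count p xs = sum (map (b2n ∘ p) xs)

count≤length : {A : Set} (p : A → Bool) (xs : List A) → count p xs ℕ.≤ length xs
count≤length p []       = z≤n
count≤length p (x ∷ xs) = ℕP.+-mono-≤ (b2n≤1 (p x)) (count≤length p xs)
  where
  b2n≤1 : ∀ b → b2n b ℕ.≤ 1
  b2n≤1 true  = s≤s z≤n
  b2n≤1 false = z≤n

member≤sum : {A : Set} (f : A → ℕ) {xs : List A} {a : A} → a ∈ xs → f a ℕ.≤ sum (map f xs)
member≤sum f (here refl) = ℕP.m≤m+n _ _
member≤sum f (there a∈) = ℕP.≤-trans (member≤sum f a∈) (ℕP.m≤n+m _ _)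

pair≤sum : {A : Set} (f : A → ℕ) {xs : List A} {a b : A} →
           a ∈ xs → b ∈ xs → a ≢ b → f a ℕ.+ f b ℕ.≤ sum (map f xs)
pair≤sum f (here refl) (here refl) a≢b = ⊥-elim (a≢b refl)
pair≤sum f (here refl) (there b∈) _   = ℕP.+-monoʳ-≤ (f _) (member≤sum f b∈)
pair≤sum f {a = a} {b} (there a∈) (here refl) _ =
  ℕP.≤-trans (ℕP.≤-reflexive (ℕP.+-comm (f a) (f b))) (ℕP.+-monoʳ-≤ (f b) (member≤sum f a∈))
pair≤sum f (there a∈) (there b∈) a≢b = ℕP.≤-trans (pair≤sum f a∈ b∈ a≢b) (ℕP.m≤n+m _ _)

sum-mono : {A : Set} (f g : A → ℕ) (xs : List A) →
           (∀ a → f a ℕ.≤ g a) → sum (map f xs) ℕ.≤ sum (map g xs)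
sum-mono f g []       f≤g = z≤n
sum-mono f g (x ∷ xs) f≤g = ℕP.+-mono-≤ (f≤g x) (sum-mono f g xs f≤g)

sum-tight : {A : Set} (f g : A → ℕ) (xs : List A) → (∀ a → f a ℕ.≤ g a) →
            sum (map g xs) ℕ.≤ sum (map f xs) → All (λ a → f a ≡ g a) xs
sum-tight f g []       f≤g _     = []
sum-tight f g (x ∷ xs) f≤g total =
  ℕP.≤-antisym (f≤g x) head≤ ∷ sum-tight f g xs f≤g tail≤
  where
  Σf = sum (map f xs)
  Σg = sum (map g xs)
  head≤ : g x ℕ.≤ f x
  head≤ = ℕP.+-cancelʳ-≤ Σg (g x) (f x)
    (ℕP.≤-trans total (ℕP.+-monoʳ-≤ (f x) (sum-mono f g xs f≤g)))
  tail≤ : Σg ℕ.≤ Σf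
  tail≤ = ℕP.+-cancelˡ-≤ (g x) Σg Σf
    (ℕP.≤-trans total (ℕP.+-monoˡ-≤ Σf (f≤g x)))

plateau : (s : ℕ → ℕ) (B : ℕ) → (∀ t → s t ℕ.≤ s (suc t)) → (∀ t → s t ℕ.≤ B) →
          Σ ℕ λ T → s (suc T) ≡ s T
plateau s B increasing bounded with search (suc B)
  where
  -- either a plateau occurs before k, or s has grown by at least one per step
  search : ∀ k → (Σ ℕ λ T → s (suc T) ≡ s T) ⊎ k ℕ.≤ s k
  search zero = inj₂ z≤n
  search (suc k) with search k
  ... | inj₁ found = inj₁ found
  ... | inj₂ k≤sk with s (suc k) ℕ.≟ s k
  ...   | yes same = inj₁ (k , same)
  ...   | no grows = inj₂ (ℕP.≤-trans (s≤s k≤sk) (ℕP.≤∧≢⇒< (increasing k) (grows ∘ sym)))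
... | inj₁ found = found
... | inj₂ too-big = ⊥-elim (ℕP.<⇒≱ too-big (bounded (suc B)))

true≢false : true ≢ false
true≢false ()

b2n-mono : ∀ {a b} → (a ≡ true → b ≡ true) → b2n a ℕ.≤ b2n b
b2n-mono {false} _ = z≤n
b2n-mono {true}  a⇒b rewrite a⇒b refl = s≤s z≤n

b2n-injective : ∀ {a b} → b2n a ≡ b2n b → a ≡ b
b2n-injective {true}  {true}  _ = refl
b2n-injective {false} {false} _ = refl

stabilises : {A : Set} (xs : List A) (f : ℕ → A → Bool) →
             (∀ t {a} → f t a ≡ true → f (suc t) a ≡ true) →
             Σ ℕ λ T → All (λ a → f (suc T) a ≡ f T a) xs
stabilises xs f increasing with plateau size (length xs) grows (λ t → count≤length (f t) xs)
  where
  size : ℕ → ℕ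
  size t = count (f t) xs
  grows : ∀ t → size t ℕ.≤ size (suc t)
  grows t = sum-mono _ _ xs (λ a → b2n-mono (increasing t))
... | T , same = T , all-map (λ e → sym (b2n-injective e))
  (sum-tight (b2n ∘ f T) (b2n ∘ f (suc T)) xs (λ a → b2n-mono (increasing T)) (ℕP.≤-reflexive same))

data Dir : Set where
  E W N S : Dir

step : Dir → Site → Site
step E (i , j) = (i ℤ.+ 1ℤ , j)
step W (i , j) = (i ℤ.- 1ℤ , j)
step N (i , j) = (i , j ℤ.+ 1ℤ)
step S (i , j) = (i , j ℤ.- 1ℤ)

directions : List Dir
directions = E ∷ W ∷ N ∷ S ∷ []

∈-directions : ∀ d → d ∈ directions
∈-directions E = here refl
∈-directions W = there (here refl)
∈-directions N = there (there (here refl))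
∈-directions S = there (there (there (here refl)))

activeNbrs-count : ∀ c w → activeNbrs c w ≡ count (λ d → c (step d w)) directions
activeNbrs-count c (i , j) = regroup (active E) (active W) (active N) (active S)
  where
  regroup : ∀ a b c d → a ℕ.+ b ℕ.+ c ℕ.+ d ≡ a ℕ.+ (b ℕ.+ (c ℕ.+ (d ℕ.+ 0)))
  regroup = ℕ-solve-∀
  active : Dir → ℕ
  active d = b2n (c (step d (i , j)))

F-local : ∀ c c′ w w′ → c w ≡ c′ w′ → (∀ d → c (step d w) ≡ c′ (step d w′)) →
          F234 c w ≡ F234 c′ w′
F-local c c′ (i , j) (i′ , j′) same nbrs =
  cong₂ (λ a k → a ∨ ((2 ≤ᵇ k) ∧ (k ≤ᵇ 4))) same
    (cong₂ ℕ._+_ (cong₂ ℕ._+_ (cong₂ ℕ._+_ (nbr E) (nbr W)) (nbr N)) (nbr S))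
  where
  nbr : ∀ d → b2n (c (step d (i , j))) ≡ b2n (c′ (step d (i′ , j′)))
  nbr d = cong b2n (nbrs d)

F-increasing : ∀ c w → c w ≡ true → F234 c w ≡ true
F-increasing c w on = cong (_∨ ((2 ≤ᵇ activeNbrs c w) ∧ (activeNbrs c w ≤ᵇ 4))) on

iterate-increasing : ∀ c w s t → iterateF t c w ≡ true → iterateF (s ℕ.+ t) c w ≡ true
iterate-increasing c w zero    t on = on
iterate-increasing c w (suc s) t on = F-increasing (iterateF (s ℕ.+ t) c) w (iterate-increasing c w s t on)

fires : ∀ c w {d₁ d₂} → d₁ ≢ d₂ → c (step d₁ w) ≡ true → c (step d₂ w) ≡ true →
        F234 c w ≡ true
fires c w {d₁} {d₂} d₁≢d₂ on₁ on₂ =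
  trans (cong (c w ∨_) (cong₂ _∧_ (≤-true at-least-two) (≤-true at-most-four))) (∨-zeroʳ (c w))
  where
  active : Dir → Bool
  active d = c (step d w)
  ≤-true : ∀ {m k} → m ℕ.≤ k → (m ≤ᵇ k) ≡ true
  ≤-true m≤k = Equivalence.to T-≡ (ℕP.≤⇒≤ᵇ m≤k)
  at-least-two : 2 ℕ.≤ activeNbrs c w
  at-least-two = subst₂ ℕ._≤_ (cong₂ ℕ._+_ (cong b2n on₁) (cong b2n on₂)) (sym (activeNbrs-count c w))
    (pair≤sum (b2n ∘ active) (∈-directions d₁) (∈-directions d₂) d₁≢d₂)
  at-most-four : activeNbrs c w ℕ.≤ 4
  at-most-four = subst (ℕ._≤ 4) (sym (activeNbrs-count c w)) (count≤length active directions)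

SameMod : (M : ℕ) → .{{NonZero M}} → Site → Site → Set
SameMod M (i , j) (i′ , j′) = i %ℕ M ≡ i′ %ℕ M × j %ℕ M ≡ j′ %ℕ M

Periodic : (M : ℕ) → .{{NonZero M}} → Config → Set
Periodic M c = ∀ w w′ → SameMod M w w′ → c w ≡ c w′

step-SameMod : ∀ M .{{_ : NonZero M}} d w w′ → SameMod M w w′ → SameMod M (step d w) (step d w′)
step-SameMod M E (i , j) (i′ , j′) (i≡ , j≡) = %ℕ-+-cong M i i′ 1ℤ i≡ , j≡
step-SameMod M W (i , j) (i′ , j′) (i≡ , j≡) = %ℕ-+-cong M i i′ (- 1ℤ) i≡ , j≡
step-SameMod M N (i , j) (i′ , j′) (i≡ , j≡) = i≡ , %ℕ-+-cong M j j′ 1ℤ j≡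
step-SameMod M S (i , j) (i′ , j′) (i≡ , j≡) = i≡ , %ℕ-+-cong M j j′ (- 1ℤ) j≡

-- rule 234 commutes with translations, so it preserves periodicity
iterate-periodic : ∀ M .{{_ : NonZero M}} c → Periodic M c → ∀ t → Periodic M (iterateF t c)
iterate-periodic M c periodic zero    = periodic
iterate-periodic M c periodic (suc t) w w′ same =
  F-local (iterateF t c) (iterateF t c) w w′ (iterate-periodic M c periodic t w w′ same)
    (λ d → iterate-periodic M c periodic t (step d w) (step d w′) (step-SameMod M d w w′ same))

window : ℕ → List Site
window M = cartesianProductWith (λ a b → (+ a , + b)) (upTo M) (upTo M)

representative : ∀ M .{{_ : NonZero M}} w → Σ Site λ v → v ∈ window M × SameMod M w v
representative M (i , j) =
  (+ (i %ℕ M) , + (j %ℕ M)) ,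
  ∈-cartesianProductWith⁺ (λ a b → (+ a , + b)) (∈-upTo⁺ (n%ℕd<d i M)) (∈-upTo⁺ (n%ℕd<d j M)) ,
  sym (m<n⇒m%n≡m (n%ℕd<d i M)) , sym (m<n⇒m%n≡m (n%ℕd<d j M))

-- The orbit of a periodic configuration under rule 234 becomes constant: it
-- is determined by finitely many cells, each of which can only switch on.
eventually-fixed : ∀ M .{{_ : NonZero M}} c → Periodic M c →
                   Σ ℕ λ T → ∀ w → iterateF (suc T) c w ≡ iterateF T c w
eventually-fixed M c periodic
  with stabilises (window M) (λ t → iterateF t c) (λ t {w} → F-increasing (iterateF t c) w)
... | T , fixed-on-window = T , fixed
  where
  fixed : ∀ w → iterateF (suc T) c w ≡ iterateF T c w
  fixed w with representative M w
  ... | v , v∈ , same = begin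
    iterateF (suc T) c w  ≡⟨ iterate-periodic M c periodic (suc T) w v same ⟩
    iterateF (suc T) c v  ≡⟨ lookup fixed-on-window v∈ ⟩
    iterateF T c v        ≡⟨ iterate-periodic M c periodic T w v same ⟨
    iterateF T c w        ∎
    where open ≡-Reasoning

module Stabilised (c : Config) (T : ℕ)
                  (fixed : ∀ w → iterateF (suc T) c w ≡ iterateF T c w) where

  iterate-fixed : ∀ s w → iterateF (s ℕ.+ T) c w ≡ iterateF T c w
  iterate-fixed zero    w = refl
  iterate-fixed (suc s) w = trans
    (F-local (iterateF (s ℕ.+ T) c) (iterateF T c) w w (iterate-fixed s w) (λ d → iterate-fixed s (step d w)))
    (fixed w)

  stable-at-T : ∀ w → iterateF T c w ≡ false → Stable c w
  stable-at-T w off = never 0 , never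
    where
    never : ∀ t → iterateF t c w ≡ false
    never t with iterateF t c w in on
    ... | false = refl
    ... | true  = ⊥-elim (true≢false (begin
      true                       ≡⟨ iterate-increasing c w T t on ⟨
      iterateF (T ℕ.+ t) c w     ≡⟨ cong (λ s → iterateF s c w) (ℕP.+-comm T t) ⟩
      iterateF (t ℕ.+ T) c w     ≡⟨ iterate-fixed t w ⟩
      iterateF T c w             ≡⟨ off ⟩
      false                      ∎))
      where open ≡-Reasoning

  active-at-T : ∀ w → ¬ Stable c w → iterateF T c w ≡ true
  active-at-T w unstable with iterateF T c w in at-T
  ... | true  = refl
  ... | false = ⊥-elim (unstable (stable-at-T w at-T))

  stable? : ∀ w → Dec (Stable c w)
  stable? w with iterateF T c w in at-T
  ... | false = yes (stable-at-T w at-T)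
  ... | true  = no (λ st → true≢false (trans (sym at-T) (proj₂ st T)))

  -- two unstable neighbours would be active at time T and activate w
  no-two-unstable : ∀ w {d₁ d₂} → Stable c w → d₁ ≢ d₂ →
                    ¬ Stable c (step d₁ w) → ¬ Stable c (step d₂ w) → ⊥
  no-two-unstable w {d₁} {d₂} st d₁≢d₂ unstable₁ unstable₂ =
    true≢false (trans (sym (fires (iterateF T c) w d₁≢d₂ (active-at-T _ unstable₁) (active-at-T _ unstable₂)))
                      (proj₂ st (suc T)))

  stable-choice : ∀ w {d₁ d₂} → Stable c w → d₁ ≢ d₂ →
                  Stable c (step d₁ w) ⊎ Stable c (step d₂ w)
  stable-choice w {d₁} {d₂} st d₁≢d₂ with stable? (step d₁ w) | stable? (step d₂ w)
  ... | yes st₁ | _       = inj₁ st₁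
  ... | no _    | yes st₂ = inj₂ st₂
  ... | no u₁   | no u₂   = ⊥-elim (no-two-unstable w st d₁≢d₂ u₁ u₂)

  stable-beside : ∀ w d d′ → Stable c w → ¬ Stable c (step d w) → d′ ≢ d → Stable c (step d′ w)
  stable-beside w d d′ st unstable d′≢d with stable-choice w st d′≢d
  ... | inj₁ st′ = st′
  ... | inj₂ st₁ = ⊥-elim (unstable st₁)

Dc-periodic : ∀ n .{{_ : NonZero n}} x → Periodic (blockSize n) {{blockSize-nonZero n}} (Dc n x)
Dc-periodic n x (i , j) (i′ , j′) (i≡ , j≡) = cong₂ value (shift i i′ i≡) (shift j j′ j≡)
  where
  instance _ = blockSize-nonZero n
  m = blockSize n
  value : ℕ → ℕ → Bool
  value a b = if interiorᵇ n a ∧ interiorᵇ n b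
              then x (fromℕ< (m%n<n a n)) (fromℕ< (m%n<n b n)) else false
  shift : ∀ i i′ → i %ℕ m ≡ i′ %ℕ m → (i ℤ.+ + offset n) %ℕ m ≡ (i′ ℤ.+ + offset n) %ℕ m
  shift i i′ = %ℕ-+-cong m i i′ (+ offset n)

-- A coordinate of the interior moved by at most one stays in the block,
-- because the border is a frame of width n ≥ 1 around the interior.
frame : ∀ n .{{_ : NonZero n}} {i} δ → Interior1 n i → - 1ℤ ℤ.≤ δ → δ ℤ.≤ 1ℤ →
        InBlock1 n (i ℤ.+ δ)
frame n {i} δ (lo , hi) δ≥-1 δ≤1 =
  subst (ℤ._≤ i ℤ.+ δ) left (ℤP.+-mono-≤ lo (ℤP.≤-trans -n≤-1 δ≥-1)) ,
  subst (i ℤ.+ δ ℤ.≤_) right (ℤP.+-mono-≤ hi (ℤP.≤-trans δ≤1 1≤n))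
  where
  open ≡-Reasoning
  1≤n : 1ℤ ℤ.≤ + n
  1≤n = ℤ.+≤+ (ℕ.>-nonZero⁻¹ n)
  -n≤-1 : - (+ n) ℤ.≤ - 1ℤ
  -n≤-1 = ℤP.neg-mono-≤ 1≤n
  left : - (+ (n ℕ.* n)) ℤ.+ - (+ n) ≡ - (+ offset n)
  left = begin
    - (+ (n ℕ.* n)) ℤ.+ - (+ n)  ≡⟨ ℤP.neg-distrib-+ (+ (n ℕ.* n)) (+ n) ⟨
    - (+ (n ℕ.* n) ℤ.+ + n)      ≡⟨ cong -_ (ℤP.pos-+ (n ℕ.* n) n) ⟨
    - (+ offset n)               ∎
  right : + (n ℕ.* n ℕ.+ n) ℤ.- 1ℤ ℤ.+ + n ≡ + (n ℕ.* n ℕ.+ 2 ℕ.* n) ℤ.- 1ℤ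
  right = begin
    + (n ℕ.* n ℕ.+ n) ℤ.- 1ℤ ℤ.+ + n    ≡⟨ swap (+ (n ℕ.* n ℕ.+ n)) (+ n) ⟩
    + (n ℕ.* n ℕ.+ n) ℤ.+ + n ℤ.- 1ℤ    ≡⟨ cong (ℤ._- 1ℤ) (ℤP.pos-+ (n ℕ.* n ℕ.+ n) n) ⟨
    + (n ℕ.* n ℕ.+ n ℕ.+ n) ℤ.- 1ℤ      ≡⟨ cong (λ k → + k ℤ.- 1ℤ) (twice n) ⟩
    + (n ℕ.* n ℕ.+ 2 ℕ.* n) ℤ.- 1ℤ      ∎
    where
    swap : ∀ a b → a ℤ.- 1ℤ ℤ.+ b ≡ a ℤ.+ b ℤ.- 1ℤ
    swap = solve-∀
    twice : ∀ n → n ℕ.* n ℕ.+ n ℕ.+ n ≡ n ℕ.* n ℕ.+ 2 ℕ.* n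
    twice = ℕ-solve-∀

interior⇒block1 : ∀ n .{{_ : NonZero n}} {i} → Interior1 n i → InBlock1 n i
interior⇒block1 n {i} int = subst (InBlock1 n) (ℤP.+-identityʳ i) (frame n 0ℤ int (ℤ.-≤+) (ℤ.+≤+ z≤n))

interior⇒block : ∀ n .{{_ : NonZero n}} v → Interior n v → InBlock n v
interior⇒block n (i , j) (int-i , int-j) = interior⇒block1 n int-i , interior⇒block1 n int-j

step-block : ∀ n .{{_ : NonZero n}} d v → Interior n v → InBlock n (step d v)
step-block n E (i , j) (int-i , int-j) = frame n 1ℤ int-i ℤ.-≤+ ℤP.≤-refl , interior⇒block1 n int-j
step-block n W (i , j) (int-i , int-j) = frame n (- 1ℤ) int-i ℤP.≤-refl ℤ.-≤+ , interior⇒block1 n int-j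
step-block n N (i , j) (int-i , int-j) = interior⇒block1 n int-i , frame n 1ℤ int-j ℤ.-≤+ ℤP.≤-refl
step-block n S (i , j) (int-i , int-j) = interior⇒block1 n int-i , frame n (- 1ℤ) int-j ℤP.≤-refl ℤ.-≤+

congruent : ∀ {n} .{{_ : NonZero n}} a b → a ≡ b → ModEq (blockSize n) {{blockSize-nonZero n}} a b
congruent {n} a b refl = trans (cong (_%ℕ blockSize n) (ℤP.+-inverseʳ a)) (m<n⇒m%n≡m (ℕ.>-nonZero⁻¹ (blockSize n)))
  where instance _ = blockSize-nonZero n

back : ∀ a → a ℤ.- 1ℤ ℤ.+ 1ℤ ≡ a
back = solve-∀

interior? : ∀ n v → Dec (Interior n v)
interior? n (i , j) = (interval i) ×-dec (interval j)
  where
  interval : ∀ i → Dec (Interior1 n i)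
  interval i = (- (+ (n ℕ.* n)) ℤP.≤? i) ×-dec (i ℤP.≤? + (n ℕ.* n ℕ.+ n) ℤ.- 1ℤ)

step-adjacent : ∀ n .{{_ : NonZero n}} d v → TorusAdj n v (step d v)
step-adjacent n E (i , j) = inj₂ (congruent j j refl , inj₁ (congruent (i ℤ.+ 1ℤ) (i ℤ.+ 1ℤ) refl))
step-adjacent n W (i , j) = inj₂ (congruent j j refl , inj₂ (congruent (i ℤ.- 1ℤ ℤ.+ 1ℤ) i (back i)))
step-adjacent n N (i , j) = inj₁ (congruent i i refl , inj₁ (congruent (j ℤ.+ 1ℤ) (j ℤ.+ 1ℤ) refl))
step-adjacent n S (i , j) = inj₁ (congruent i i refl , inj₂ (congruent (j ℤ.- 1ℤ ℤ.+ 1ℤ) j (back j)))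

opp : Dir → Dir
opp E = W
opp W = E
opp N = S
opp S = N

proj : Dir → Site → ℤ
proj E (i , j) = i
proj W (i , j) = - i
proj N (i , j) = j
proj S (i , j) = - j

proj-step : ∀ d v → proj d (step d v) ≡ proj d v ℤ.+ 1ℤ
proj-step E v       = refl
proj-step W (i , j) = ℤP.neg-distrib-+ i (- 1ℤ)
proj-step N v       = refl
proj-step S (i , j) = ℤP.neg-distrib-+ j (- 1ℤ)

opp-≤ : ∀ d u w → proj (opp d) u ℤ.≤ proj (opp d) w → proj d w ℤ.≤ proj d u
opp-≤ E (_ , _) (_ , _) = ℤP.neg-cancel-≤
opp-≤ W (_ , _) (_ , _) = ℤP.neg-mono-≤
opp-≤ N (_ , _) (_ , _) = ℤP.neg-cancel-≤
opp-≤ S (_ , _) (_ , _) = ℤP.neg-mono-≤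

opp-< : ∀ d u w → proj (opp d) u ℤ.< proj (opp d) w → proj d w ℤ.< proj d u
opp-< E (_ , _) (_ , _) = ℤP.neg-cancel-<
opp-< W (_ , _) (_ , _) = ℤP.neg-mono-<
opp-< N (_ , _) (_ , _) = ℤP.neg-cancel-<
opp-< S (_ , _) (_ , _) = ℤP.neg-mono-<

-- perpendicular directions (a quadrant is spanned by a perpendicular pair)
data Perp : Dir → Dir → Set where
  EN : Perp E N
  ES : Perp E S
  WN : Perp W N
  WS : Perp W S
  NE : Perp N E
  NW : Perp N W
  SE : Perp S E
  SW : Perp S W

perp-sym : ∀ {a b} → Perp a b → Perp b a
perp-sym EN = NE
perp-sym ES = SE
perp-sym WN = NW
perp-sym WS = SW
perp-sym NE = EN
perp-sym NW = WN
perp-sym SE = ES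
perp-sym SW = WS

perp-opp : ∀ {a b} → Perp a b → Perp a (opp b)
perp-opp EN = ES
perp-opp ES = EN
perp-opp WN = WS
perp-opp WS = WN
perp-opp NE = NW
perp-opp NW = NE
perp-opp SE = SW
perp-opp SW = SE

perp≢ : ∀ {a b} → Perp a b → a ≢ b
perp≢ EN ()
perp≢ ES ()
perp≢ WN ()
perp≢ WS ()
perp≢ NE ()
perp≢ NW ()
perp≢ SE ()
perp≢ SW ()

proj-perp : ∀ {a b} → Perp a b → ∀ v → proj a (step b v) ≡ proj a v
proj-perp EN v = refl
proj-perp ES v = refl
proj-perp WN v = refl
proj-perp WS v = refl
proj-perp NE v = refl
proj-perp NW v = refl
proj-perp SE v = refl
proj-perp SW v = refl

bound : ℕ → Dir → ℤ
bound n E = + (n ℕ.* n ℕ.+ n) ℤ.- 1ℤ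
bound n W = + (n ℕ.* n)
bound n N = + (n ℕ.* n ℕ.+ n) ℤ.- 1ℤ
bound n S = + (n ℕ.* n)

proj≤bound : ∀ n d v → Interior n v → proj d v ℤ.≤ bound n d
proj≤bound n E (i , j) ((lo , hi) , _) = hi
proj≤bound n W (i , j) ((lo , hi) , _) = subst (- i ℤ.≤_) (ℤP.neg-involutive _) (ℤP.neg-mono-≤ lo)
proj≤bound n N (i , j) (_ , (lo , hi)) = hi
proj≤bound n S (i , j) (_ , (lo , hi)) = subst (- j ℤ.≤_) (ℤP.neg-involutive _) (ℤP.neg-mono-≤ lo)

-- Walking
-- greedily through stable sites in these two directions, a walk started in
-- the block never turns back, so its sites are pairwise distinct, and it
-- leaves the interior after at most room v steps, landing on the border.
module Staircase {n} .{{_ : NonZero n}} (x : Fin n → Fin n → Bool)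
                 {d₁ d₂ : Dir} (perp : Perp d₁ d₂)
                 (advance : ∀ v → Stable (Dc n x) v →
                            Stable (Dc n x) (step d₁ v) ⊎ Stable (Dc n x) (step d₂ v)) where

  -- distance from v to the far corner of the interior along d₁ and d₂
  room : Site → ℤ
  room v = (bound n d₁ ℤ.- proj d₁ v) ℤ.+ (bound n d₂ ℤ.- proj d₂ v)

  room≥0 : ∀ v → Interior n v → 0ℤ ℤ.≤ room v
  room≥0 v int =
    ℤP.+-mono-≤ (ℤP.i≤j⇒0≤j-i (proj≤bound n d₁ v int)) (ℤP.i≤j⇒0≤j-i (proj≤bound n d₂ v int))

  Next : Site → Site → Set
  Next v w = w ≡ step d₁ v ⊎ w ≡ step d₂ v

  Beyond : Site → Site → Set
  Beyond v w = proj d₁ v ℤ.≤ proj d₁ w × proj d₂ v ℤ.≤ proj d₂ w × room w ℤ.< room v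

  beyond-trans : ∀ {u v w} → Beyond u v → Beyond v w → Beyond u w
  beyond-trans (a , b , r) (a′ , b′ , r′) = ℤP.≤-trans a a′ , ℤP.≤-trans b b′ , ℤP.<-trans r′ r

  -- hence a staircase walk never revisits a site
  beyond⇒≢ : ∀ {v w} → Beyond v w → v ≢ w
  beyond⇒≢ (_ , _ , r) refl = ℤP.<-irrefl refl r

  next-room : ∀ v w → Next v w → 1ℤ ℤ.+ room w ≡ room v
  next-room v _ (inj₁ refl) = begin
    1ℤ ℤ.+ room (step d₁ v)
      ≡⟨ cong₂ (λ a b → 1ℤ ℤ.+ ((bound n d₁ ℤ.- a) ℤ.+ (bound n d₂ ℤ.- b)))
               (proj-step d₁ v) (proj-perp (perp-sym perp) v) ⟩
    1ℤ ℤ.+ ((bound n d₁ ℤ.- (proj d₁ v ℤ.+ 1ℤ)) ℤ.+ (bound n d₂ ℤ.- proj d₂ v))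
      ≡⟨ regroup (bound n d₁) (proj d₁ v) (bound n d₂) (proj d₂ v) ⟩
    room v ∎
    where
    open ≡-Reasoning
    regroup : ∀ b₁ p₁ b₂ p₂ →
              1ℤ ℤ.+ ((b₁ ℤ.- (p₁ ℤ.+ 1ℤ)) ℤ.+ (b₂ ℤ.- p₂)) ≡ (b₁ ℤ.- p₁) ℤ.+ (b₂ ℤ.- p₂)
    regroup = solve-∀
  next-room v _ (inj₂ refl) = begin
    1ℤ ℤ.+ room (step d₂ v)
      ≡⟨ cong₂ (λ a b → 1ℤ ℤ.+ ((bound n d₁ ℤ.- a) ℤ.+ (bound n d₂ ℤ.- b)))
               (proj-perp perp v) (proj-step d₂ v) ⟩
    1ℤ ℤ.+ ((bound n d₁ ℤ.- proj d₁ v) ℤ.+ (bound n d₂ ℤ.- (proj d₂ v ℤ.+ 1ℤ)))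
      ≡⟨ regroup (bound n d₁) (proj d₁ v) (bound n d₂) (proj d₂ v) ⟩
    room v ∎
    where
    open ≡-Reasoning
    regroup : ∀ b₁ p₁ b₂ p₂ →
              1ℤ ℤ.+ ((b₁ ℤ.- p₁) ℤ.+ (b₂ ℤ.- (p₂ ℤ.+ 1ℤ))) ≡ (b₁ ℤ.- p₁) ℤ.+ (b₂ ℤ.- p₂)
    regroup = solve-∀

  next-beyond : ∀ v w → Next v w → Beyond v w
  next-beyond v w nx = ahead₁ nx , ahead₂ nx , ℤP.suc[i]≤j⇒i<j (ℤP.≤-reflexive (next-room v w nx))
    where
    moved : ∀ d → proj d v ℤ.≤ proj d (step d v)
    moved d = ℤP.≤-trans (ℤP.i≤i+j (proj d v) 1ℤ) (ℤP.≤-reflexive (sym (proj-step d v)))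
    ahead₁ : Next v w → proj d₁ v ℤ.≤ proj d₁ w
    ahead₁ (inj₁ refl) = moved d₁
    ahead₁ (inj₂ refl) = ℤP.≤-reflexive (sym (proj-perp perp v))
    ahead₂ : Next v w → proj d₂ v ℤ.≤ proj d₂ w
    ahead₂ (inj₁ refl) = ℤP.≤-reflexive (sym (proj-perp (perp-sym perp) v))
    ahead₂ (inj₂ refl) = moved d₂

  next-adjacent : ∀ v w → Next v w → TorusAdj n v w
  next-adjacent v _ (inj₁ refl) = step-adjacent n d₁ v
  next-adjacent v _ (inj₂ refl) = step-adjacent n d₂ v

  next-block : ∀ v w → Interior n v → Next v w → InBlock n w
  next-block v _ int (inj₁ refl) = step-block n d₁ v int
  next-block v _ int (inj₂ refl) = step-block n d₂ v int

  next : ∀ v → Stable (Dc n x) v → Σ Site λ w → Next v w × Stable (Dc n x) w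
  next v st with advance v st
  ... | inj₁ st₁ = step d₁ v , inj₁ refl , st₁
  ... | inj₂ st₂ = step d₂ v , inj₂ refl , st₂

  -- a walk from v (excluded) to the border through stable open sites
  record Walk (v : Site) (ws : List Site) : Set where
    field
      stable     : All (Stable (Dc n x)) ws
      open-sites : All (InZ n x) ws
      linked     : Linked (TorusAdj n) (v ∷ ws)
      ends       : Border n (lastOf v ws)
      beyond     : All (Beyond v) ws
      distinct   : Unique (v ∷ ws)

  stop : ∀ v → InBlock n v → ¬ Interior n v → Walk v []
  stop v blk outside = record
    { stable = [] ; open-sites = [] ; linked = [-] ; ends = blk , outside
    ; beyond = [] ; distinct = [] ∷ [] }

  extend : ∀ v w {ws} → Interior n v → Next v w → Stable (Dc n x) w → Walk w ws → Walk v (w ∷ ws)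
  extend v w int nx st walk = record
    { stable = st ∷ stable
    ; open-sites = (next-block v w int nx , proj₁ st) ∷ open-sites
    ; linked = next-adjacent v w nx ∷ linked
    ; ends = ends
    ; beyond = all-beyond
    ; distinct = all-map beyond⇒≢ all-beyond ∷ distinct }
    where
    open Walk walk
    all-beyond = next-beyond v w nx ∷ all-map (beyond-trans (next-beyond v w nx)) beyond

  -- the greedy walk from a stable site of the block, with fuel f > room v
  walk : ∀ f v → Stable (Dc n x) v → InBlock n v → (Interior n v → room v ℤ.< + f) →
         Σ (List Site) (Walk v)
  walk f v st blk fuel with interior? n v
  walk f       v st blk fuel | no outside = [] , stop v blk outside
  walk zero    v st blk fuel | yes int    = ⊥-elim (ℤP.<⇒≱ (fuel int) (room≥0 v int))
  walk (suc f) v st blk fuel | yes int    with next v st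
  ... | w , nx , st′ with walk f w st′ (next-block v w int nx) (λ _ → fuel′)
    where
    -- w has less room than v, and v had room below f + 1
    fuel′ : room w ℤ.< + f
    fuel′ = ℤP.<-≤-trans (proj₂ (proj₂ (next-beyond v w nx))) (ℤP.i<j⇒i≤pred[j] (fuel int))
  ...   | ws , rest = w ∷ ws , extend v w int nx st′ rest

  Ahead : Site → Site → Set
  Ahead u w = proj d₁ u ℤ.< proj d₁ w × proj d₂ u ℤ.≤ proj d₂ w

  path : ∀ u → Stable (Dc n x) u → Interior n u → Stable (Dc n x) (step d₁ u) →
         Σ (List Site) λ ws → PathToBorder n x u ws × All (Stable (Dc n x)) (u ∷ ws) × All (Ahead u) ws
  path u st int st₁ with walk (suc ℤ.∣ room (step d₁ u) ∣) (step d₁ u) st₁ (step-block n d₁ u int)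
                              (λ _ → ℤP.≤-<-trans (≤-abs (room (step d₁ u))) (ℤ.+<+ (ℕP.n<1+n _)))
    where
    ≤-abs : ∀ i → i ℤ.≤ + ℤ.∣ i ∣
    ≤-abs (+ _)      = ℤP.≤-refl
    ≤-abs ℤ.-[1+ _ ] = ℤ.-≤+
  ... | ws , rest =
    step d₁ u ∷ ws ,
    ((interior⇒block n u int , proj₁ st) ∷ open-sites , distinct , linked , ends) ,
    st ∷ stable ,
    first ∷ all-map (λ (a₁ , a₂ , _) → ℤP.<-≤-trans (proj₁ first) a₁ , ℤP.≤-trans (proj₂ first) a₂)
                    (Walk.beyond rest)
    where
    open Walk (extend u (step d₁ u) int (inj₁ refl) st₁ rest)
    first : Ahead u (step d₁ u)
    first = ℤP.suc[i]≤j⇒i<j (ℤP.≤-reflexive (trans (ℤP.+-comm 1ℤ (proj d₁ u)) (sym (proj-step d₁ u)))) ,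
            ℤP.≤-reflexive (sym (proj-perp (perp-sym perp) u))

ThreePaths : (n : ℕ) → .{{NonZero n}} → (Fin n → Fin n → Bool) → Site → Set
ThreePaths n x u =
  Σ (List Site) λ p₁ → Σ (List Site) λ p₂ → Σ (List Site) λ p₃ →
  PathToBorder n x u p₁ × PathToBorder n x u p₂ × PathToBorder n x u p₃ ×
  OnlyCommon u p₁ p₂ × OnlyCommon u p₁ p₃ × OnlyCommon u p₂ p₃ ×
  All (Stable (Dc n x)) (u ∷ p₁) × All (Stable (Dc n x)) (u ∷ p₂) × All (Stable (Dc n x)) (u ∷ p₃)

only-common : ∀ u {p q} {P Q : Site → Set} → All P p → All Q q → (∀ {w} → P w → Q w → ⊥) →
              OnlyCommon u p q
only-common u _  _  _    w (here w≡u)   _            = w≡u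
only-common u _  _  _    w (there _)    (here w≡u)   = w≡u
only-common u ps qs excl w (there w∈p) (there w∈q) = ⊥-elim (excl (lookup ps w∈p) (lookup qs w∈q))

siteOf-interior : ∀ n .{{_ : NonZero n}} (u : Fin n × Fin n) → Interior n (siteOf u)
siteOf-interior n (a , b) = coordinate (toℕ<n a) , coordinate (toℕ<n b)
  where
  coordinate : ∀ {t} → t ℕ.< n → Interior1 n (+ t)
  coordinate {t} t<n =
    ℤP.neg-≤-pos ,
    subst (+ t ℤ.≤_) (ℤP.+-comm (- 1ℤ) (+ (n ℕ.* n ℕ.+ n)))
      (ℤP.i<j⇒i≤pred[j] (ℤ.+<+ (ℕP.<-≤-trans t<n (ℕP.m≤n+m n (n ℕ.* n)))))

module ThreePathsFrom {n} .{{_ : NonZero n}} (x : Fin n → Fin n → Bool) (T : ℕ)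
         (fixed : ∀ w → iterateF (suc T) (Dc n x) w ≡ iterateF T (Dc n x) w) where
  open Stabilised (Dc n x) T fixed

  advance : ∀ {d₁ d₂} → Perp d₁ d₂ → ∀ v → Stable (Dc n x) v →
            Stable (Dc n x) (step d₁ v) ⊎ Stable (Dc n x) (step d₂ v)
  advance perp v st = stable-choice v st (perp≢ perp)

  -- staircase paths in the quadrants (a, -b), (b, a) and (-a, b)
  three : ∀ {a b} → Perp a b → ∀ u → Stable (Dc n x) u → Interior n u →
          Stable (Dc n x) (step a u) → Stable (Dc n x) (step b u) → Stable (Dc n x) (step (opp a) u) →
          ThreePaths n x u
  three {a} {b} ab u st int st-a st-b st-opp-a
    with Staircase.path x (perp-opp ab) (advance (perp-opp ab)) u st int st-a
       | Staircase.path x (perp-sym ab) (advance (perp-sym ab)) u st int st-b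
       | Staircase.path x -ab (advance -ab) u st int st-opp-a
    where
    -ab : Perp (opp a) b
    -ab = perp-sym (perp-opp (perp-sym ab))
  ... | p₁ , path₁ , stable₁ , ahead₁ | p₂ , path₂ , stable₂ , ahead₂ | p₃ , path₃ , stable₃ , ahead₃ =
    -- the quadrants are separated by the coordinate along b, resp. along a
    p₁ , p₂ , p₃ , path₁ , path₂ , path₃ ,
    only-common u ahead₁ ahead₂ (λ (_ , b≤) (b< , _) → ℤP.<⇒≱ b< (opp-≤ b u _ b≤)) ,
    only-common u ahead₁ ahead₃ (λ (a< , _) (-a< , _) → ℤP.<⇒≱ a< (ℤP.<⇒≤ (opp-< a u _ -a<))) ,
    only-common u ahead₂ ahead₃ (λ (_ , a≤) (-a< , _) → ℤP.<⇒≱ (opp-< a u _ -a<) a≤) ,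
    stable₁ , stable₂ , stable₃

  -- at most one neighbour of u is unstable; choose a, b avoiding it
  three-paths : ∀ u → Stable (Dc n x) u → Interior n u → ThreePaths n x u
  three-paths u st int with stable? (step E u) | stable? (step N u) | stable? (step W u)
  ... | no ¬E | _ | _ =
    three NW u st int (stable-beside u E N st ¬E λ ()) (stable-beside u E W st ¬E λ ())
                      (stable-beside u E S st ¬E λ ())
  ... | yes st-E | no ¬N | _ =
    three ES u st int st-E (stable-beside u N S st ¬N λ ()) (stable-beside u N W st ¬N λ ())
  ... | yes st-E | yes st-N | no ¬W =
    three NE u st int st-N st-E (stable-beside u W S st ¬W λ ())
  ... | yes st-E | yes st-N | yes st-W =
    three EN u st int st-E st-N st-W

lemma5 : (n : ℕ) → .{{_ : NonZero n}} → (x : Fin n → Fin n → Bool) →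
         (u : Fin n × Fin n) → Stable (Dc n x) (siteOf u) →
         Σ (List Site) λ p₁ → Σ (List Site) λ p₂ → Σ (List Site) λ p₃ →
           PathToBorder n x (siteOf u) p₁ × PathToBorder n x (siteOf u) p₂ ×
           PathToBorder n x (siteOf u) p₃ ×
           OnlyCommon (siteOf u) p₁ p₂ × OnlyCommon (siteOf u) p₁ p₃ ×
           OnlyCommon (siteOf u) p₂ p₃ ×
           All (Stable (Dc n x)) (siteOf u ∷ p₁) ×
           All (Stable (Dc n x)) (siteOf u ∷ p₂) ×
           All (Stable (Dc n x)) (siteOf u ∷ p₃)
lemma5 n x u st =
  ThreePathsFrom.three-paths x T fixed (siteOf u) st (siteOf-interior n u)
  where
  orbit-constant : Σ ℕ λ T → ∀ w → iterateF (suc T) (Dc n x) w ≡ iterateF T (Dc n x) w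
  orbit-constant = eventually-fixed (blockSize n) {{blockSize-nonZero n}} (Dc n x) (Dc-periodic n x)
  T : ℕ
  T = proj₁ orbit-constant
  fixed : ∀ w → iterateF (suc T) (Dc n x) w ≡ iterateF T (Dc n x) w
  fixed = proj₂ orbit-constant
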